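{- For every graph $G$, $\mathrm{bpw}(G)\leqslant 2\,\text{path- }\alpha(G)+1$ and $\mathrm{btw}(G)\leqslant 2\,\text{tree- }\alpha(G)+1$.
   Context: A tree decomposition of $G$ is a pair $(T,\{X_s\}_{s\in V(T)})$ with $T$ a tree and bags $X_s\subseteq V(G)$ such that every vertex lies in some bag, every edge has both endpoints in some bag, and for each vertex the nodes whose bags contain it induce a connected subtree; a path decomposition is one where $T$ is a path. Width is $\max|X_s|-1$; treewidth $\mathrm{tw}$ and pathwidth $\mathrm{pw}$ are minimum widths. The independence number of a decomposition is $\max_s\alpha(G[X_s])$; $\text{tree- }\alpha(G)$ (resp. $\text{path- }\alpha(G)$) is its minimum over tree (resp. path) decompositions. $\mathrm{bpw}(G)$ (bipartite pathwidth) is the maximum of $\mathrm{pw}(H)$ over bipartite induced subgraphs $H$ of $G$, and $\mathrm{btw}(G)$ (bipartite treewidth) is the maximum of $\mathrm{tw}(H)$ over bipartite induced subgraphs $H$ of $G$. -}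

module Defs where

open import Data.Nat using (ℕ; zero; suc; _+_; _*_; _≤_; _<_)
open import Data.Fin using (Fin; toℕ)
open import Data.Fin.Subset using (Subset; _∈_; _⊆_; ∣_∣)
open import Data.Bool using (Bool)
open import Data.List using (List; []; _∷_; _++_; length)
open import Data.List.Relation.Unary.Unique.Propositional using (Unique)
open import Data.Product using (Σ; ∃; _×_; _,_)
open import Data.Sum using (_⊎_)
open import Data.Unit using (⊤)
open import Relation.Nullary using (¬_)
open import Relation.Binary.PropositionalEquality using (_≡_; _≢_)

record Graph (n : ℕ) : Set₁ where
  field
    Adj    : Fin n → Fin n → Set
    sym    : ∀ {u v} → Adj u v → Adj v u
    irrefl : ∀ {u} → ¬ Adj u u
open Graph public

-- Walks in T that stay inside the node set P (starting node assumed in P).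
data Reach {m : ℕ} (T : Graph m) (P : Fin m → Set) : Fin m → Fin m → Set where
  here : ∀ {s} → Reach T P s s
  step : ∀ {s t u} → Reach T P s t → Adj T t u → P u → Reach T P s u

ConnectedSet : ∀ {m} → Graph m → (Fin m → Set) → Set
ConnectedSet T P = ∀ s t → P s → P t → Reach T P s t

Chain : ∀ {m} → Graph m → List (Fin m) → Set
Chain T []             = ⊤
Chain T (x ∷ [])       = ⊤
Chain T (x ∷ y ∷ xs)   = Adj T x y × Chain T (y ∷ xs)

HasCycle : ∀ {m} → Graph m → Set
HasCycle {m} T =
  Σ (Fin m) λ x → Σ (List (Fin m)) λ xs →
    (2 ≤ length xs) × Unique (x ∷ xs) × Chain T (x ∷ xs ++ x ∷ [])

IsTree : ∀ {m} → Graph m → Set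
IsTree {m} T = (0 < m) × ConnectedSet T (λ _ → ⊤) × ¬ HasCycle T

PathGraph : (m : ℕ) → Graph m
PathGraph m = record
  { Adj    = λ i j → (suc (toℕ i) ≡ toℕ j) ⊎ (suc (toℕ j) ≡ toℕ i)
  ; sym    = symP
  ; irrefl = irr
  }
  where
  open import Data.Sum using (inj₁; inj₂)
  open import Data.Nat.Properties using (1+n≢n)
  
  symP : ∀ {i j : Fin m} → (suc (toℕ i) ≡ toℕ j) ⊎ (suc (toℕ j) ≡ toℕ i)
                         → (suc (toℕ j) ≡ toℕ i) ⊎ (suc (toℕ i) ≡ toℕ j)
  symP (inj₁ p) = inj₂ p
  symP (inj₂ p) = inj₁ p
  irr : ∀ {i : Fin m} → ¬ ((suc (toℕ i) ≡ toℕ i) ⊎ (suc (toℕ i) ≡ toℕ i))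
  irr {i} (inj₁ p) = 1+n≢n p
  irr {i} (inj₂ p) = 1+n≢n p

record Decomposition {n m : ℕ} (G : Graph n) (S : Subset n) (T : Graph m) : Set where
  field
    bag       : Fin m → Subset n
    bag⊆S     : ∀ s → bag s ⊆ S
    cover     : ∀ v → v ∈ S → ∃ λ s → v ∈ bag s
    edgeCover : ∀ u v → u ∈ S → v ∈ S → Adj G u v → ∃ λ s → (u ∈ bag s × v ∈ bag s)
    interp    : ∀ v → ConnectedSet T (λ s → v ∈ bag s)
open Decomposition public

record TreeDecomposition {n : ℕ} (G : Graph n) (S : Subset n) : Set₁ where
  field
    nodes  : ℕ
    tree   : Graph nodes
    isTree : IsTree tree
    dec    : Decomposition G S tree
open TreeDecomposition public

record PathDecomposition {n : ℕ} (G : Graph n) (S : Subset n) : Set where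
  field
    len : ℕ
    dec : Decomposition G S (PathGraph (suc len))
open PathDecomposition public

WidthAtMost : ∀ {n m} {G : Graph n} {S : Subset n} {T : Graph m} →
              Decomposition G S T → ℕ → Set
WidthAtMost {m = m} D k = ∀ (s : Fin m) → ∣ bag D s ∣ ≤ suc k

Independent : ∀ {n} → Graph n → Subset n → Set
Independent G I = ∀ u v → u ∈ I → v ∈ I → ¬ Adj G u v

IndepNumAtMost : ∀ {n} → Graph n → Subset n → ℕ → Set
IndepNumAtMost {n} G X a = ∀ (I : Subset n) → I ⊆ X → Independent G I → ∣ I ∣ ≤ a

DecIndepAtMost : ∀ {n m} {G : Graph n} {S : Subset n} {T : Graph m} →
                 Decomposition G S T → ℕ → Set
DecIndepAtMost {m = m} {G = G} D a = ∀ (s : Fin m) → IndepNumAtMost G (bag D s) a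

BipartiteOn : ∀ {n} → Graph n → Subset n → Set
BipartiteOn {n} G S =
  Σ (Fin n → Bool) λ c → ∀ u v → u ∈ S → v ∈ S → Adj G u v → c u ≢ c v

PathwidthAtMost : ∀ {n} → Graph n → Subset n → ℕ → Set
PathwidthAtMost G S k = Σ (PathDecomposition G S) λ P → WidthAtMost (dec P) k

TreewidthAtMost : ∀ {n} → Graph n → Subset n → ℕ → Set₁
TreewidthAtMost G S k = Σ (TreeDecomposition G S) λ P → WidthAtMost (dec P) k

Path-αAtMost : ∀ {n} → Graph n → ℕ → Set
Path-αAtMost {n} G a = Σ (PathDecomposition G Data.Fin.Subset.⊤) λ P → DecIndepAtMost (dec P) a

Tree-αAtMost : ∀ {n} → Graph n → ℕ → Set₁
Tree-αAtMost {n} G a = Σ (TreeDecomposition G Data.Fin.Subset.⊤) λ P → DecIndepAtMost (dec P) a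

BpwAtMost : ∀ {n} → Graph n → ℕ → Set
BpwAtMost {n} G k = ∀ (S : Subset n) → BipartiteOn G S → PathwidthAtMost G S k

BtwAtMost : ∀ {n} → Graph n → ℕ → Set₁
BtwAtMost {n} G k = ∀ (S : Subset n) → BipartiteOn G S → TreewidthAtMost G S k

-- Restricting every bag of a decomposition of G to a set S gives a decomposition
-- of G[S] over the same tree. If G[S] is bipartite, each restricted bag splits into
-- its two colour classes, which are independent sets inside the original bag and so
-- have at most α vertices each; the restricted bags thus have at most 2α vertices.
module Submission where

open import Defs hiding (sym)
open import Data.Bool using (Bool; true; false)
open import Data.Bool.Properties using (¬-not)
open import Data.Fin using (Fin)
open import Data.Fin.Subset using (Subset; _∈_; _⊆_; ∣_∣; _∩_; ∁; inside; outside)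
  renaming (⊤ to full)
open import Data.Fin.Subset.Properties
  using (∈⊤; x∈p∩q⁺; p∩q⊆p; p∩q⊆q; x∈∁p⇒x∉p)
open import Data.Nat using (ℕ; suc; _+_; _*_; _≤_)
open import Data.Nat.Properties
  using (+-suc; +-mono-≤; +-identityʳ; ≤-trans; ≤-reflexive; m≤m+n; n≤1+n)
open import Data.Product using (_×_; _,_)
open import Data.Vec using (_∷_; []; tabulate)
open import Data.Vec.Properties using (lookup∘tabulate; []=⇒lookup; lookup⇒[]=)
open import Relation.Binary.PropositionalEquality using (_≡_; _≢_; refl; sym; trans; cong)

private
  variable
    n m : ℕ

∣p∣≡∣p∩q∣+∣p∩∁q∣ : (p q : Subset n) → ∣ p ∣ ≡ ∣ p ∩ q ∣ + ∣ p ∩ ∁ q ∣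
∣p∣≡∣p∩q∣+∣p∩∁q∣ []            []            = refl
∣p∣≡∣p∩q∣+∣p∩∁q∣ (outside ∷ p) (_ ∷ q)       = ∣p∣≡∣p∩q∣+∣p∩∁q∣ p q
∣p∣≡∣p∩q∣+∣p∩∁q∣ (inside ∷ p)  (inside ∷ q)  = cong suc (∣p∣≡∣p∩q∣+∣p∩∁q∣ p q)
∣p∣≡∣p∩q∣+∣p∩∁q∣ (inside ∷ p)  (outside ∷ q) =
  trans (cong suc (∣p∣≡∣p∩q∣+∣p∩∁q∣ p q)) (sym (+-suc ∣ p ∩ q ∣ ∣ p ∩ ∁ q ∣))

∈tabulate⇒true : (c : Fin n → Bool) {v : Fin n} → v ∈ tabulate c → c v ≡ true
∈tabulate⇒true c {v} v∈ = trans (sym (lookup∘tabulate c v)) ([]=⇒lookup v∈)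

∈∁tabulate⇒false : (c : Fin n → Bool) {v : Fin n} → v ∈ ∁ (tabulate c) → c v ≡ false
∈∁tabulate⇒false c {v} v∈ = ¬-not λ cv≡true →
  x∈∁p⇒x∉p v∈ (lookup⇒[]= v (tabulate c) (trans (lookup∘tabulate c v) cv≡true))

monochromatic⇒independent : (G : Graph n) {S I : Subset n} (c : Fin n → Bool) (b : Bool) →
  (∀ u v → u ∈ S → v ∈ S → Adj G u v → c u ≢ c v) →
  I ⊆ S → (∀ {v} → v ∈ I → c v ≡ b) → Independent G I
monochromatic⇒independent G c b proper I⊆S mono u v u∈I v∈I uv =
  proper u v (I⊆S u∈I) (I⊆S v∈I) uv (trans (mono u∈I) (sym (mono v∈I)))

bipartite⇒∣X∩S∣≤a+a : (G : Graph n) {S X : Subset n} {a : ℕ} →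
  IndepNumAtMost G X a → BipartiteOn G S → ∣ X ∩ S ∣ ≤ a + a
bipartite⇒∣X∩S∣≤a+a G {S} {X} {a} α≤a (c , proper) = begin
  ∣ Y ∣                                         ≡⟨ ∣p∣≡∣p∩q∣+∣p∩∁q∣ Y (tabulate c) ⟩
  ∣ Y ∩ tabulate c ∣ + ∣ Y ∩ ∁ (tabulate c) ∣  ≤⟨ +-mono-≤ (class true (∈tabulate⇒true c))
                                                              (class false (∈∁tabulate⇒false c)) ⟩
  a + a                                         ∎
  where
  open Data.Nat.Properties.≤-Reasoning
  Y = X ∩ S
  class : ∀ {C} b → (∀ {v} → v ∈ C → c v ≡ b) → ∣ Y ∩ C ∣ ≤ a
  class {C} b C-colour = α≤a (Y ∩ C) (λ v∈ → p∩q⊆p X S (p∩q⊆p Y C v∈))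
    (monochromatic⇒independent G c b proper
      (λ v∈ → p∩q⊆q X S (p∩q⊆p Y C v∈))
      (λ v∈ → C-colour (p∩q⊆q Y C v∈)))

Reach-mono : {T : Graph m} {P Q : Fin m → Set} → (∀ {s} → P s → Q s) →
  ∀ {s t} → Reach T P s t → Reach T Q s t
Reach-mono P⊆Q here           = here
Reach-mono P⊆Q (step r st Pt) = step (Reach-mono P⊆Q r) st (P⊆Q Pt)

restrict : {G : Graph n} {T : Graph m} (S : Subset n) →
  Decomposition G full T → Decomposition G S T
restrict S D = record
  { bag       = λ s → bag D s ∩ S
  ; bag⊆S     = λ s → p∩q⊆q (bag D s) S
  ; cover     = λ v v∈S →
      let s , v∈bag = cover D v ∈⊤ in s , x∈p∩q⁺ (v∈bag , v∈S)
  ; edgeCover = λ u v u∈S v∈S uv →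
      let s , u∈bag , v∈bag = edgeCover D u v ∈⊤ ∈⊤ uv
      in s , x∈p∩q⁺ (u∈bag , u∈S) , x∈p∩q⁺ (v∈bag , v∈S)
  ; interp    = λ v s t v∈s v∈t →
      let v∈S = p∩q⊆q (bag D s) S v∈s in
      Reach-mono (λ v∈bag → x∈p∩q⁺ (v∈bag , v∈S))
        (interp D v s t (p∩q⊆p (bag D s) S v∈s) (p∩q⊆p (bag D t) S v∈t))
  }

restrict-width : {G : Graph n} {T : Graph m} {S : Subset n} {a : ℕ} →
  BipartiteOn G S → (D : Decomposition G full T) →
  DecIndepAtMost D a → WidthAtMost (restrict S D) (2 * a + 1)
restrict-width {G = G} {a = a} bipartite D α≤a s =
  ≤-trans (bipartite⇒∣X∩S∣≤a+a G (α≤a s) bipartite) a+a≤2a+2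
  where
  a+a≤2a+2 : a + a ≤ suc (2 * a + 1)
  a+a≤2a+2 = ≤-trans (≤-reflexive (cong (a +_) (sym (+-identityʳ a))))
                     (≤-trans (m≤m+n (2 * a) 1) (n≤1+n (2 * a + 1)))

proposition1 : ∀ {n : ℕ} (G : Graph n) →
    (∀ (a : ℕ) → Path-αAtMost G a → BpwAtMost G (2 * a + 1)) ×
    (∀ (a : ℕ) → Tree-αAtMost G a → BtwAtMost G (2 * a + 1))
proposition1 G = bpw , btw
  where
  bpw : ∀ a → Path-αAtMost G a → BpwAtMost G (2 * a + 1)
  bpw a (P , α≤a) S bipartite =
    record { len = len P ; dec = restrict S (dec P) } ,
    restrict-width bipartite (dec P) α≤a

  btw : ∀ a → Tree-αAtMost G a → BtwAtMost G (2 * a + 1)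
  btw a (P , α≤a) S bipartite =
    record { nodes = nodes P ; tree = tree P ; isTree = isTree P ; dec = restrict S (dec P) } ,
    restrict-width bipartite (dec P) α≤a
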